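{- For $n\geq 2$, $|\hat{\mathcal{B}}_n(211)|=\sum_{k=1}^{n-1}k^{n-k-1}$.
   Context: An endofunction of size $n$ is a word $x=x_1\cdots x_n$ with entries in $\{1,\dots,n\}$; it is a Cayley permutation if it contains every integer between $1$ and $\max(x)$. Let $\mathrm{Ascbot}(x)=\{1\}\cup\{i:1\leq i\leq n-1,\ x_i<x_{i+1}\}$ and $\mathrm{Nub}(x)$ the set of indices $i$ such that $x_i$ is the leftmost occurrence of its value. A revised ascent sequence of length $n$ is a Cayley permutation $x$ of length $n$ with $\mathrm{Ascbot}(x)=\mathrm{Nub}(x)$. For Cayley permutations $x$ and $\sigma=\sigma_1\cdots\sigma_k$, $x$ contains $\sigma$ if there are indices $i_1<\cdots<i_k$ such that for all $s,t$: $x_{i_s}<x_{i_t}\iff\sigma_s<\sigma_t$ and $x_{i_s}=x_{i_t}\iff\sigma_s=\sigma_t$; otherwise $x$ avoids $\sigma$. $\hat{\mathcal{B}}_n(\sigma)$ is the set of revised ascent sequences of length $n$ avoiding $\sigma$. -}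

module Defs where

open import Data.Nat using (ℕ; zero; suc; _+_; _∸_; _^_; _<ᵇ_; _≡ᵇ_; _⊔_)
open import Data.Bool using (T; T?; Bool; true; false; _∧_; _∨_; not; if_then_else_)
open import Data.List using (List; []; _∷_; length; map; filter; concatMap; foldr; take; applyUpTo)
open import Data.Bool.ListAction using (all; any)
open import Data.Nat.ListAction using (sum)
open import Data.Product using (_×_; _,_)
open import Function using (_∘_)
open import Relation.Nullary.Decidable using (Dec; yes; no)
open import Relation.Binary.PropositionalEquality using (_≡_)

-- Words are lists of natural numbers; positions are 1-indexed as in the paper.

_==_ : Bool → Bool → Bool
true == b = b
false == b = not b

wordsOver : ℕ → ℕ → List (List ℕ)
wordsOver n zero = [] ∷ []
wordsOver n (suc k) = concatMap (λ v → map (v ∷_) (wordsOver n k)) (applyUpTo suc n)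

endofunctions : ℕ → List (List ℕ)
endofunctions n = wordsOver n n

maxW : List ℕ → ℕ
maxW = foldr _⊔_ 0

elemᵇ : ℕ → List ℕ → Bool
elemᵇ v xs = any (λ y → v ≡ᵇ y) xs

isCayley : List ℕ → Bool
isCayley x = all (λ v → elemᵇ v x) (applyUpTo suc (maxW x))

-- x_i (1-indexed), default 0 out of range
at : List ℕ → ℕ → ℕ
at [] i = 0
at (x ∷ xs) zero = 0
at (x ∷ xs) (suc zero) = x
at (x ∷ xs) (suc (suc i)) = at xs (suc i)

inAscbot : List ℕ → ℕ → Bool
inAscbot x i = (i ≡ᵇ 1) ∨ ((i <ᵇ length x) ∧ (at x i <ᵇ at x (suc i)))

inNub : List ℕ → ℕ → Bool
inNub x i = not (elemᵇ (at x i) (take (i ∸ 1) x))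

ascbotEqNub : List ℕ → Bool
ascbotEqNub x = all (λ i → inAscbot x i == inNub x i) (applyUpTo suc (length x))

isRevisedAscent : List ℕ → Bool
isRevisedAscent x = isCayley x ∧ ascbotEqNub x

subseqs : ℕ → List ℕ → List (List ℕ)
subseqs zero xs = [] ∷ []
subseqs (suc k) [] = []
subseqs (suc k) (x ∷ xs) = map (x ∷_) (subseqs k xs) ++ subseqs (suc k) xs
  where
  _++_ : List (List ℕ) → List (List ℕ) → List (List ℕ)
  [] ++ ys = ys
  (a ∷ as) ++ ys = a ∷ (as ++ ys)

orderIso : List ℕ → List ℕ → Bool
orderIso y σ =
  all (λ s → all (λ t →
        ((at y s <ᵇ at y t) == (at σ s <ᵇ at σ t)) ∧
        ((at y s ≡ᵇ at y t) == (at σ s ≡ᵇ at σ t)))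
      idx) idx
  where idx = applyUpTo suc (length σ)

contains : List ℕ → List ℕ → Bool
contains x σ = any (λ y → orderIso y σ) (subseqs (length σ) x)

avoids : List ℕ → List ℕ → Bool
avoids x σ = not (contains x σ)

-- |B̂_n(σ)|: number of revised ascent sequences of length n avoiding σ
-- (every revised ascent sequence of length n is an endofunction of size n)
countB : ℕ → List ℕ → ℕ
countB n σ = length (filter (λ x → T? (isRevisedAscent x ∧ avoids x σ)) (endofunctions n))

rhs : ℕ → ℕ
rhs n = sum (map (λ k → k ^ (n ∸ k ∸ 1)) (applyUpTo suc (n ∸ 1)))

-- A 211-avoiding revised ascent sequence x of length n ≥ 2 starts with its maximum m: position 1
-- lies in Ascbot by definition, while a leftmost occurrence of m at any later position would be a
-- nub that is not an ascent bottom. A repeated value b < m would give the pattern m b b, so every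
-- value below m occurs exactly once, and Ascbot = Nub then says that every later entry other than
-- m is smaller than its successor. Hence x = m y, where y consists of k ≥ 1 strictly increasing
-- runs, each ending in m, that together contain 1, …, m − 1 once each, and n = k + m. Recording
-- the run of each value is a bijection onto {1, …, k}^(m − 1): its inverse inserts m − 1, …, 1,
-- in this order, at the start of their runs. So there are k^(n−k−1) such x for each k.

module Submission where

open import Defs
open import Data.Nat using (ℕ; _≤_)
open import Data.List using (List; []; _∷_)
open import Relation.Binary.PropositionalEquality using (_≡_)

open import Data.Nat using (zero; suc; pred; _+_; _*_; _∸_; _^_; _<_; _<ᵇ_; _≡ᵇ_; z≤n; s≤s; _≟_; _≤?_)
open import Data.Nat.Properties
open import Data.Nat.ListAction using (sum)
open import Data.Bool using (Bool; true; false; T; T?; not; _∧_)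
open import Data.Bool.Properties using (T-∧)
open import Data.Bool.ListAction using (all)
open import Data.Empty using (⊥; ⊥-elim)
open import Data.Unit using (⊤)
open import Data.Sum using (inj₁; inj₂)
open import Data.Product using (∃₂; _×_; _,_; proj₁; proj₂)
import Data.List as List
open import Data.List using (length; map; filter; concatMap; applyUpTo; replicate; take; _++_)
open import Data.List.Properties
  using (length-++; length-map; length-replicate; length-applyUpTo; map-cong; ++-assoc; ++-identityʳ;
         filter-accept; filter-reject; ∷-injectiveˡ; ∷-injectiveʳ)
open import Data.List.Membership.Propositional using (_∈_; _∉_; find; lose)
open import Data.List.Membership.Propositional.Properties
  using (∈-map⁺; ∈-map⁻; ∈-concatMap⁺; ∈-concatMap⁻; ∈-applyUpTo⁺; ∈-applyUpTo⁻; ∈-filter⁺; ∈-filter⁻;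
         ∈-++⁺ˡ; ∈-++⁺ʳ; ∈-++⁻)
open import Data.List.Membership.Propositional.Properties.WithK using (unique∧set⇒bag)
open import Data.List.Relation.Binary.BagAndSetEquality using (∼bag⇒↭)
open import Data.List.Relation.Binary.Permutation.Propositional using (_↭_; ↭-refl; ↭-prep; ↭-swap; ↭-trans; ↭-sym)
import Data.List.Relation.Binary.Permutation.Propositional as ↭
open import Data.List.Relation.Binary.Permutation.Propositional.Properties
  using (↭-length; All-resp-↭; ∈-resp-↭; filter-↭)
open import Data.List.Relation.Binary.Sublist.Propositional
  using (_⊆_; []; _∷_; _∷ʳ_; minimum; from∈; to∈) renaming (lookup to ⊆-lookup)
open import Data.List.Relation.Binary.Sublist.Propositional.Properties using (∷⁻)
open import Data.List.Relation.Unary.All as All using (All; []; _∷_)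
open import Data.List.Relation.Unary.All.Properties using (all⁺; all⁻; applyUpTo⁺₁; applyUpTo⁻; replicate⁺)
open import Data.List.Relation.Unary.Any as Any using (Any; here; there)
open import Data.List.Relation.Unary.Any.Properties using (any⁺; any⁻)
open import Data.List.Relation.Unary.AllPairs using ([]; _∷_)
open import Data.List.Relation.Unary.Unique.Propositional using (Unique)
import Data.List.Relation.Unary.Unique.Propositional.Properties as Unique
open import Function using (_∘_; _⇔_; mk⇔; Equivalence)
open import Function.Properties.Equivalence using () renaming (trans to ⇔-trans)
open import Data.Product.Function.NonDependent.Propositional using (_×-⇔_)
open import Relation.Nullary using (¬_; yes; no)
open import Relation.Nullary.Reflects using (ofʸ; ofⁿ; det; fromEquivalence)
open import Relation.Binary.PropositionalEquality
  using (refl; sym; trans; cong; cong₂; subst; _≢_; ≢-sym; module ≡-Reasoning)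

open Equivalence using (to; from)

unique∧set⇒length≡ : {A : Set} {xs ys : List A} → Unique xs → Unique ys →
                     (∀ {z} → z ∈ xs ⇔ z ∈ ys) → length xs ≡ length ys
unique∧set⇒length≡ ux uy same = ↭-length (∼bag⇒↭ (unique∧set⇒bag ux uy same))

unique-map : {A B : Set} (f : A → B) {xs : List A} → (∀ {x y} → x ∈ xs → y ∈ xs → f x ≡ f y → x ≡ y) →
             Unique xs → Unique (map f xs)
unique-map f {[]}     _   []          = []
unique-map f {x ∷ xs} inj (x∉xs ∷ u) = All.tabulate fresh ∷ unique-map f (λ p q → inj (there p) (there q)) u
  where
  fresh : ∀ {z} → z ∈ map f xs → f x ≢ z
  fresh z∈ fx≡z with ∈-map⁻ f z∈
  ... | y , y∈xs , refl = All.lookup x∉xs y∈xs (inj (here refl) (there y∈xs) fx≡z)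

unique-concatMap : {A B : Set} (f : A → List B) {xs : List A} → Unique xs →
                   (∀ {x} → x ∈ xs → Unique (f x)) →
                   (∀ {x y z} → x ∈ xs → y ∈ xs → z ∈ f x → z ∈ f y → x ≡ y) →
                   Unique (concatMap f xs)
unique-concatMap f {[]} [] _ _ = []
unique-concatMap f {x ∷ xs} (x∉xs ∷ u) uf sep =
  Unique.++⁺ (uf (here refl)) (unique-concatMap f u (uf ∘ there) (λ p q → sep (there p) (there q))) disjoint
  where
  disjoint : ∀ {z} → ¬ (z ∈ f x × z ∈ concatMap f xs)
  disjoint (z∈fx , z∈rest) with find (∈-concatMap⁻ f {xs = xs} z∈rest)
  ... | y , y∈xs , z∈fy = All.lookup x∉xs y∈xs (sep (here refl) (there y∈xs) z∈fx z∈fy)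

length-concatMap : {A B : Set} (f : A → List B) (xs : List A) →
                   length (concatMap f xs) ≡ sum (map (length ∘ f) xs)
length-concatMap f []       = refl
length-concatMap f (x ∷ xs) = trans (length-++ (f x)) (cong (length (f x) +_) (length-concatMap f xs))

length-concatMap-const : {A B : Set} (f : A → List B) {c : ℕ} → (∀ x → length (f x) ≡ c) →
                         ∀ xs → length (concatMap f xs) ≡ length xs * c
length-concatMap-const f eq []       = refl
length-concatMap-const f eq (x ∷ xs) = trans (length-++ (f x)) (cong₂ _+_ (eq x) (length-concatMap-const f eq xs))

WordOver : ℕ → List ℕ → Set
WordOver n = All (λ a → 1 ≤ a × a ≤ n)

∈-wordsOver⁺ : ∀ {n} k {x} → length x ≡ k → WordOver n x → x ∈ wordsOver n k
∈-wordsOver⁺ zero {[]} refl [] = here refl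
∈-wordsOver⁺ {n} (suc k) {suc a ∷ x} refl ((s≤s z≤n , a<n) ∷ wx) =
  ∈-concatMap⁺ (λ v → map (v ∷_) (wordsOver n k))
    (lose (∈-applyUpTo⁺ suc a<n) (∈-map⁺ (suc a ∷_) (∈-wordsOver⁺ k refl wx)))

∈-wordsOver⁻ : ∀ n k {x} → x ∈ wordsOver n k → length x ≡ k × WordOver n x
∈-wordsOver⁻ n zero (here refl) = refl , []
∈-wordsOver⁻ n (suc k) x∈
  with find (∈-concatMap⁻ (λ v → map (v ∷_) (wordsOver n k)) {xs = applyUpTo suc n} x∈)
... | v , v∈ , x∈v with ∈-map⁻ (v ∷_) x∈v | ∈-applyUpTo⁻ suc v∈
... | y , y∈ , refl | i , i<n , refl with ∈-wordsOver⁻ n k y∈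
... | refl , wy = refl , (s≤s z≤n , i<n) ∷ wy

unique-wordsOver : ∀ n k → Unique (wordsOver n k)
unique-wordsOver n zero    = [] ∷ []
unique-wordsOver n (suc k) =
  unique-concatMap (λ v → map (v ∷_) (wordsOver n k))
    (Unique.applyUpTo⁺₁ suc n (λ i<j _ → <⇒≢ i<j ∘ suc-injective))
    (λ _ → Unique.map⁺ ∷-injectiveʳ (unique-wordsOver n k))
    (λ _ _ → same-head)
  where
  same-head : ∀ {u v z} → z ∈ map (u ∷_) (wordsOver n k) → z ∈ map (v ∷_) (wordsOver n k) → u ≡ v
  same-head p q with ∈-map⁻ _ p | ∈-map⁻ _ q
  ... | _ , _ , refl | _ , _ , refl = refl

length-wordsOver : ∀ n k → length (wordsOver n k) ≡ n ^ k
length-wordsOver n zero    = refl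
length-wordsOver n (suc k) =
  trans (length-concatMap-const (λ v → map (v ∷_) (wordsOver n k)) (λ v → length-map (v ∷_) (wordsOver n k))
                                (applyUpTo suc n))
        (cong₂ _*_ (length-applyUpTo suc n) (length-wordsOver n k))

occ : ℕ → List ℕ → ℕ
occ w = length ∘ filter (w ≟_)

occ-here : ∀ v y → occ v (v ∷ y) ≡ suc (occ v y)
occ-here v y = cong length (filter-accept (v ≟_) refl)

occ-there : ∀ {w a} y → w ≢ a → occ w (a ∷ y) ≡ occ w y
occ-there y w≢a = cong length (filter-reject (_ ≟_) w≢a)

occ≤occ-∷ : ∀ w a y → occ w y ≤ occ w (a ∷ y)
occ≤occ-∷ w a y with w ≟ a
... | yes refl = ≤-trans (n≤1+n _) (≤-reflexive (sym (occ-here w y)))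
... | no  w≢a  = ≤-reflexive (sym (occ-there y w≢a))

occ-resp-↭ : ∀ w {xs ys} → xs ↭ ys → occ w xs ≡ occ w ys
occ-resp-↭ w xs↭ys = ↭-length (filter-↭ (w ≟_) xs↭ys)

∉⇒occ≡0 : ∀ {w} y → w ∉ y → occ w y ≡ 0
∉⇒occ≡0 []      _  = refl
∉⇒occ≡0 (a ∷ y) w∉ = trans (occ-there y (w∉ ∘ here)) (∉⇒occ≡0 y (w∉ ∘ there))

0<occ⇒∈ : ∀ {w} y → 0 < occ w y → w ∈ y
0<occ⇒∈ {w} (a ∷ y) pos with w ≟ a
... | yes refl = here refl
... | no  w≢a  = there (0<occ⇒∈ y (subst (0 <_) (occ-there y w≢a) pos))

∈⇒0<occ : ∀ {w y} → w ∈ y → 0 < occ w y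
∈⇒0<occ {w} {_ ∷ y} (here refl) = subst (0 <_) (sym (occ-here w y)) (s≤s z≤n)
∈⇒0<occ {w} {a ∷ y} (there w∈) = ≤-trans (∈⇒0<occ w∈) (occ≤occ-∷ w a y)

2≤occ⇒⊆ : ∀ {b} y → 2 ≤ occ b y → b ∷ b ∷ [] ⊆ y
2≤occ⇒⊆ {b} (a ∷ y) two with b ≟ a
... | yes refl = refl ∷ from∈ (0<occ⇒∈ y (≤-pred (subst (2 ≤_) (occ-here b y) two)))
... | no  b≢a  = a ∷ʳ 2≤occ⇒⊆ y (subst (2 ≤_) (occ-there y b≢a) two)

⊆⇒2≤occ : ∀ {b y} → b ∷ b ∷ [] ⊆ y → 2 ≤ occ b y
⊆⇒2≤occ {b} {a ∷ y} (_ ∷ʳ s)   = ≤-trans (⊆⇒2≤occ s) (occ≤occ-∷ b a y)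
⊆⇒2≤occ {b} {_ ∷ y} (refl ∷ s) = subst (2 ≤_) (sym (occ-here b y)) (s≤s (∈⇒0<occ (to∈ s)))

occ-replicate : ∀ k m → occ m (replicate k m) ≡ k
occ-replicate zero    m = refl
occ-replicate (suc k) m = trans (occ-here m (replicate k m)) (cong suc (occ-replicate k m))

replicate-occ : ∀ {m y} → All (_≡ m) y → replicate (occ m y) m ≡ y
replicate-occ {m} {[]}    []           = refl
replicate-occ {m} {_ ∷ y} (refl ∷ y≡m) =
  trans (cong (λ n → replicate n m) (occ-here m y)) (cong (m ∷_) (replicate-occ y≡m))

∉-singleton : ∀ {c m : ℕ} → c ≢ m → c ∉ m ∷ []
∉-singleton c≢m (here c≡m) = c≢m c≡m

T-==⇔ : ∀ {p q} {P Q : Set} → T p ⇔ P → T q ⇔ Q → T (p == q) ⇔ (P ⇔ Q)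
T-==⇔ {true}  {true}  p q = mk⇔ (λ _ → mk⇔ (λ _ → to q _) (λ _ → to p _)) (λ _ → _)
T-==⇔ {true}  {false} p q = mk⇔ (λ ()) (λ p⇔q → from q (to p⇔q (to p _)))
T-==⇔ {false} {true}  p q = mk⇔ (λ ()) (λ p⇔q → from p (from p⇔q (to q _)))
T-==⇔ {false} {false} p q = mk⇔ (λ _ → mk⇔ (⊥-elim ∘ from p) (⊥-elim ∘ from q)) (λ _ → _)

T-==-true : ∀ {p} → T (p == true) → T p
T-==-true {true} t = t

T-not⇔ : ∀ {p} {P : Set} → T p ⇔ P → T (not p) ⇔ (¬ P)
T-not⇔ {true}  p = mk⇔ (λ ()) (λ ¬P → ¬P (to p _))
T-not⇔ {false} p = mk⇔ (λ _ → from p) (λ _ → _)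

T-elemᵇ⇔ : ∀ {v} xs → T (elemᵇ v xs) ⇔ v ∈ xs
T-elemᵇ⇔ {v} xs = mk⇔ (Any.map (≡ᵇ⇒≡ v _) ∘ any⁻ _ xs) (any⁺ _ ∘ Any.map (≡⇒≡ᵇ v _))

T-isCayley⇔ : ∀ x → T (isCayley x) ⇔ (∀ {i} → i < maxW x → suc i ∈ x)
T-isCayley⇔ x = mk⇔ cayley⁻ cayley⁺
  where
  cayley⁻ : T (isCayley x) → ∀ {i} → i < maxW x → suc i ∈ x
  cayley⁻ t = to (T-elemᵇ⇔ x) ∘ applyUpTo⁻ suc (maxW x) (all⁺ _ _ t)
  cayley⁺ : (∀ {i} → i < maxW x → suc i ∈ x) → T (isCayley x)
  cayley⁺ h = all⁻ _ (applyUpTo⁺₁ suc (maxW x) (from (T-elemᵇ⇔ x) ∘ h))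

∈⇒≤maxW : ∀ {z x} → z ∈ x → z ≤ maxW x
∈⇒≤maxW {x = a ∷ x} (here refl) = m≤m⊔n a (maxW x)
∈⇒≤maxW {x = a ∷ x} (there z∈) = ≤-trans (∈⇒≤maxW z∈) (m≤n⊔m a (maxW x))

maxW≤ : ∀ {m x} → All (_≤ m) x → maxW x ≤ m
maxW≤ []           = z≤n
maxW≤ (a≤m ∷ x≤m) = ⊔-lub a≤m (maxW≤ x≤m)

maxW-head : ∀ {m y} → All (_≤ m) y → maxW (m ∷ y) ≡ m
maxW-head y≤m = m≥n⇒m⊔n≡m (maxW≤ y≤m)

top∈ : ∀ M {x} → (∀ {i} → i < M → suc i ∈ x) → 0 < M → M ∈ x
top∈ (suc i) covers _ = covers ≤-refl

σ₂₁₁ : List ℕ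
σ₂₁₁ = 2 ∷ 1 ∷ 1 ∷ []

-- Defs.subseqs appends with a where-bound copy of _++_, which cannot be named here; the meta appendˢ
-- is solved to it by unification in subseqs-unfold.
mutual
  appendˢ : ℕ → ℕ → List ℕ → List (List ℕ) → List (List ℕ) → List (List ℕ)
  appendˢ = _

  subseqs-unfold : ∀ k a t →
                   subseqs (suc k) (a ∷ t) ≡ appendˢ k a t (map (a ∷_) (subseqs k t)) (subseqs (suc k) t)
  subseqs-unfold k a t with map (List._∷_ a) (subseqs k t) | subseqs (suc k) t
  ... | _ | _ = refl

appendˢ≡++ : ∀ k a t xss yss → appendˢ k a t xss yss ≡ xss ++ yss
appendˢ≡++ k a t []         yss = refl
appendˢ≡++ k a t (xs ∷ xss) yss = cong (xs ∷_) (appendˢ≡++ k a t xss yss)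

subseqs-∷ : ∀ k a t → subseqs (suc k) (a ∷ t) ≡ map (a ∷_) (subseqs k t) ++ subseqs (suc k) t
subseqs-∷ k a t = trans (subseqs-unfold k a t) (appendˢ≡++ k a t (map (a ∷_) (subseqs k t)) (subseqs (suc k) t))

∈-subseqs⁺ : ∀ {z x} → z ⊆ x → z ∈ subseqs (length z) x
∈-subseqs⁺ {[]}    _          = here refl
∈-subseqs⁺ {c ∷ z} {a ∷ t} (_ ∷ʳ s) =
  subst (c ∷ z ∈_) (sym (subseqs-∷ (length z) a t)) (∈-++⁺ʳ (map (a ∷_) (subseqs (length z) t)) (∈-subseqs⁺ s))
∈-subseqs⁺ {c ∷ z} {_ ∷ t} (refl ∷ s) =
  subst (c ∷ z ∈_) (sym (subseqs-∷ (length z) c t)) (∈-++⁺ˡ (∈-map⁺ (c ∷_) (∈-subseqs⁺ s)))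

∈-subseqs⁻ : ∀ k x {z} → z ∈ subseqs k x → length z ≡ k × z ⊆ x
∈-subseqs⁻ zero    x       (here refl) = refl , minimum x
∈-subseqs⁻ (suc k) (a ∷ t) z∈ with ∈-++⁻ (map (a ∷_) (subseqs k t)) (subst (_ ∈_) (subseqs-∷ k a t) z∈)
... | inj₁ z∈kept with ∈-map⁻ (a ∷_) z∈kept
...   | z , z∈ , refl = let len , z⊆t = ∈-subseqs⁻ k t z∈ in cong suc len , refl ∷ z⊆t
∈-subseqs⁻ (suc k) (a ∷ t) z∈ | inj₂ z∈skipped =
  let len , z⊆t = ∈-subseqs⁻ (suc k) t z∈skipped in len , a ∷ʳ z⊆t

<ᵇ-false : ∀ {m n} → ¬ m < n → (m <ᵇ n) ≡ false
<ᵇ-false {m} {n} m≮n = det (<ᵇ-reflects-< m n) (ofⁿ m≮n)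

<ᵇ-true : ∀ {m n} → m < n → (m <ᵇ n) ≡ true
<ᵇ-true {m} {n} m<n = det (<ᵇ-reflects-< m n) (ofʸ m<n)

≡ᵇ-false : ∀ {m n} → m ≢ n → (m ≡ᵇ n) ≡ false
≡ᵇ-false {m} {n} m≢n = det (fromEquivalence (≡ᵇ⇒≡ m n) (≡⇒≡ᵇ m n)) (ofⁿ m≢n)

≡ᵇ-refl : ∀ m → (m ≡ᵇ m) ≡ true
≡ᵇ-refl m = det (fromEquivalence (≡ᵇ⇒≡ m m) (≡⇒≡ᵇ m m)) (ofʸ refl)

orderIso-σ₂₁₁⁺ : ∀ {a b} → b < a → T (orderIso (a ∷ b ∷ b ∷ []) σ₂₁₁)
orderIso-σ₂₁₁⁺ {a} {b} b<a
  rewrite <ᵇ-false (<-irrefl {a} refl) | <ᵇ-false (<-irrefl {b} refl) | <ᵇ-false (<⇒≯ b<a) | <ᵇ-true b<a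
        | ≡ᵇ-refl a | ≡ᵇ-refl b | ≡ᵇ-false (<⇒≢ b<a) | ≡ᵇ-false (≢-sym (<⇒≢ b<a)) = _

orderIso-σ₂₁₁⁻ : ∀ a b c → T (orderIso (a ∷ b ∷ c ∷ []) σ₂₁₁) → b < a × b ≡ c
orderIso-σ₂₁₁⁻ a b c iso =
  from-row₂ (All.lookup (all⁺ (λ s → all (agree s) positions) positions iso) (there (here refl)))
  where
  positions : List ℕ
  positions = 1 ∷ 2 ∷ 3 ∷ []
  agree : ℕ → ℕ → Bool
  agree s t = ((at (a ∷ b ∷ c ∷ []) s <ᵇ at (a ∷ b ∷ c ∷ []) t) == (at σ₂₁₁ s <ᵇ at σ₂₁₁ t)) ∧
              ((at (a ∷ b ∷ c ∷ []) s ≡ᵇ at (a ∷ b ∷ c ∷ []) t) == (at σ₂₁₁ s ≡ᵇ at σ₂₁₁ t))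
  from-row₂ : T (all (agree 2) positions) → b < a × b ≡ c
  from-row₂ row₂ with all⁺ (agree 2) positions row₂
  ... | agree₂₁ ∷ _ ∷ agree₂₃ ∷ [] =
    <ᵇ⇒< b a (T-==-true (proj₁ (to T-∧ agree₂₁))) , ≡ᵇ⇒≡ b c (T-==-true (proj₂ (to T-∧ agree₂₃)))

Contains211 : List ℕ → Set
Contains211 x = ∃₂ λ a b → b < a × a ∷ b ∷ b ∷ [] ⊆ x

T-contains-σ₂₁₁⇔ : ∀ x → T (contains x σ₂₁₁) ⇔ Contains211 x
T-contains-σ₂₁₁⇔ x = mk⇔ pattern⁻ pattern⁺
  where
  pattern⁻ : T (contains x σ₂₁₁) → Contains211 x
  pattern⁻ t with find (any⁻ _ (subseqs 3 x) t)
  ... | z , z∈ , iso with ∈-subseqs⁻ 3 x z∈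
  ... | len , z⊆x with z | len
  ... | a ∷ b ∷ c ∷ [] | refl with orderIso-σ₂₁₁⁻ a b c iso
  ...   | b<a , refl = a , b , b<a , z⊆x
  pattern⁺ : Contains211 x → T (contains x σ₂₁₁)
  pattern⁺ (a , b , b<a , s) = any⁺ _ (lose (∈-subseqs⁺ s) (orderIso-σ₂₁₁⁺ b<a))

_<Head_ : ℕ → List ℕ → Set
b <Head []      = ⊥
b <Head (c ∷ _) = b < c

≤⇒¬<Head : ∀ {m t} → All (_≤ m) t → ¬ m <Head t
≤⇒¬<Head (c≤m ∷ _) m<c = <⇒≱ m<c c≤m

<-<Head-trans : ∀ {a b} t → a < b → b <Head t → a <Head t
<-<Head-trans (_ ∷ _) a<b b<c = <-trans a<b b<c

<Head⇒0<length : ∀ {b} t → b <Head t → 0 < length t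
<Head⇒0<length (_ ∷ _) _ = s≤s z≤n

-- Ascbot = Nub on the entries of a suffix t of x, where seen lists the entries of x before t.
NubIsAscbot : List ℕ → List ℕ → Set
NubIsAscbot seen []      = ⊤
NubIsAscbot seen (b ∷ t) = (b <Head t ⇔ b ∉ seen) × NubIsAscbot (seen ++ b ∷ []) t

T-<Head⇔ : ∀ b t → T ((1 <ᵇ length (b ∷ t)) ∧ (b <ᵇ at t 1)) ⇔ b <Head t
T-<Head⇔ b []      = mk⇔ (λ ()) (λ ())
T-<Head⇔ b (c ∷ t) = mk⇔ (<ᵇ⇒< b c) <⇒<ᵇ

all-applyUpTo-cong : ∀ (p q : ℕ → Bool) (f g : ℕ → ℕ) n → (∀ i → p (f i) ≡ q (g i)) →
                     all p (applyUpTo f n) ≡ all q (applyUpTo g n)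
all-applyUpTo-cong p q f g zero    eq = refl
all-applyUpTo-cong p q f g (suc n) eq = cong₂ _∧_ (eq 0) (all-applyUpTo-cong p q (f ∘ suc) (g ∘ suc) n (eq ∘ suc))

-- The test that ascbotEqNub performs at the i-th entry of t, when t is preceded by seen.
ascbotIffNubᵇ : List ℕ → List ℕ → ℕ → Bool
ascbotIffNubᵇ seen t i =
  ((i <ᵇ length t) ∧ (at t i <ᵇ at t (suc i))) == not (elemᵇ (at t i) (seen ++ take (i ∸ 1) t))

T-all-ascbotIffNubᵇ⇔ : ∀ seen t →
                       T (all (ascbotIffNubᵇ seen t) (applyUpTo suc (length t))) ⇔ NubIsAscbot seen t
T-all-ascbotIffNubᵇ⇔ seen []      = mk⇔ (λ _ → _) (λ _ → _)
T-all-ascbotIffNubᵇ⇔ seen (b ∷ t) = ⇔-trans T-∧ (first ×-⇔ rest)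
  where
  first : T (ascbotIffNubᵇ seen (b ∷ t) 1) ⇔ (b <Head t ⇔ b ∉ seen)
  first rewrite ++-identityʳ seen = T-==⇔ (T-<Head⇔ b t) (T-not⇔ (T-elemᵇ⇔ seen))
  shift : all (ascbotIffNubᵇ seen (b ∷ t)) (applyUpTo (suc ∘ suc) (length t)) ≡
          all (ascbotIffNubᵇ (seen ++ b ∷ []) t) (applyUpTo suc (length t))
  shift = all-applyUpTo-cong _ _ (suc ∘ suc) suc (length t)
            (λ i → cong (λ s → ((suc i <ᵇ length t) ∧ (at t (suc i) <ᵇ at t (suc (suc i)))) ==
                               not (elemᵇ (at t (suc i)) s))
                        (sym (++-assoc seen (b ∷ []) (take i t))))
  rest : T (all (ascbotIffNubᵇ seen (b ∷ t)) (applyUpTo (suc ∘ suc) (length t))) ⇔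
         NubIsAscbot (seen ++ b ∷ []) t
  rest = subst (λ β → T β ⇔ NubIsAscbot (seen ++ b ∷ []) t) (sym shift) (T-all-ascbotIffNubᵇ⇔ (seen ++ b ∷ []) t)

T-ascbotEqNub⇔ : ∀ a t → T (ascbotEqNub (a ∷ t)) ⇔ NubIsAscbot (a ∷ []) t
T-ascbotEqNub⇔ a t =
  subst (λ β → T β ⇔ NubIsAscbot (a ∷ []) t)
        (all-applyUpTo-cong (ascbotIffNubᵇ (a ∷ []) t) (λ i → inAscbot (a ∷ t) i == inNub (a ∷ t) i)
                            suc (suc ∘ suc) (length t) (λ _ → refl))
        (T-all-ascbotIffNubᵇ⇔ (a ∷ []) t)

-- 211-avoiding revised ascent sequences as climbing words

data Climbs (m : ℕ) : List ℕ → Set where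
  []  : Climbs m []
  top : ∀ {t} → Climbs m t → Climbs m (m ∷ t)
  up  : ∀ {b t} → b <Head t → Climbs m t → Climbs m (b ∷ t)

climbs-tail : ∀ {m b t} → Climbs m (b ∷ t) → Climbs m t
climbs-tail (top c)  = c
climbs-tail (up _ c) = c

climbs-ascends : ∀ {m b t} → b ≢ m → Climbs m (b ∷ t) → b <Head t
climbs-ascends b≢m (top _)     = ⊥-elim (b≢m refl)
climbs-ascends b≢m (up b<t _)  = b<t

0<occ-climbs : ∀ {m y} → Climbs m y → 0 < length y → 0 < occ m y
0<occ-climbs {m} {_ ∷ t} (top _)       _ = ∈⇒0<occ {m} {m ∷ t} (here refl)
0<occ-climbs {m} {b ∷ t} (up b<t rest) _ = ≤-trans (0<occ-climbs rest (<Head⇒0<length t b<t)) (occ≤occ-∷ m b t)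

-- For v = 1 these are the tails y of the sequences m ∷ y in B̂ₙ(211); values below v are inserted later by encode.
record Admissible (m v : ℕ) (y : List ℕ) : Set where
  field
    bounded : All (λ a → v ≤ a × a ≤ m) y
    once    : ∀ {w} → v ≤ w → w < m → occ w y ≡ 1
    climbs  : Climbs m y

admissible-∈ : ∀ {m v y} → Admissible m v y → v < m → v ∈ y
admissible-∈ {y = y} adm v<m = 0<occ⇒∈ y (≤-reflexive (sym (Admissible.once adm ≤-refl v<m)))

admissible-occ≤1 : ∀ {m y} → Admissible m 1 y → ∀ {c} → c ≢ m → occ c y ≤ 1
admissible-occ≤1 {m} {y} adm {c} c≢m with occ c y in eq
... | zero  = z≤n
... | suc _ = ≤-reflexive (trans (sym eq) (once 1≤c (≤∧≢⇒< c≤m c≢m)))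
  where
  open Admissible adm
  c∈y : c ∈ y
  c∈y = 0<occ⇒∈ y (subst (0 <_) (sym eq) (s≤s z≤n))
  1≤c = proj₁ (All.lookup bounded c∈y)
  c≤m = proj₂ (All.lookup bounded c∈y)

fresh-∷ : ∀ {m b t seen} → (∀ {c} → c ∈ b ∷ t → c ≢ m → c ∉ seen) →
          (∀ {c} → c ≢ m → occ c (b ∷ t) ≤ 1) → ∀ {c} → c ∈ t → c ≢ m → c ∉ seen ++ b ∷ []
fresh-∷ {seen = seen} fresh once {c} c∈t c≢m c∈ with ∈-++⁻ seen c∈
... | inj₁ c∈seen       = fresh (there c∈t) c≢m c∈seen
... | inj₂ (here refl)  =
  <-irrefl refl (≤-trans (subst (1 <_) (sym (occ-here c _)) (s≤s (∈⇒0<occ c∈t))) (once c≢m))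

nubIsAscbot⇔climbs : ∀ {m seen y} → m ∈ seen → All (_≤ m) y →
                     (∀ {c} → c ∈ y → c ≢ m → c ∉ seen) → (∀ {c} → c ≢ m → occ c y ≤ 1) →
                     NubIsAscbot seen y ⇔ Climbs m y
nubIsAscbot⇔climbs {y = []} _ _ _ _ = mk⇔ (λ _ → []) (λ _ → _)
nubIsAscbot⇔climbs {m} {seen} {b ∷ t} m∈seen (_ ∷ t≤m) fresh once = mk⇔ climb nub
  where
  rest : NubIsAscbot (seen ++ b ∷ []) t ⇔ Climbs m t
  rest = nubIsAscbot⇔climbs (∈-++⁺ˡ m∈seen) t≤m (fresh-∷ fresh once)
                            (λ c≢m → ≤-trans (occ≤occ-∷ _ b t) (once c≢m))
  climb : NubIsAscbot seen (b ∷ t) → Climbs m (b ∷ t)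
  climb (b↑⇔fresh , nub-t) with b ≟ m
  ... | yes refl = top (to rest nub-t)
  ... | no  b≢m  = up (from b↑⇔fresh (fresh (here refl) b≢m)) (to rest nub-t)
  nub : Climbs m (b ∷ t) → NubIsAscbot seen (b ∷ t)
  nub c with b ≟ m
  ... | yes refl = mk⇔ (⊥-elim ∘ ≤⇒¬<Head t≤m) (λ m∉seen → ⊥-elim (m∉seen m∈seen)) ,
                   from rest (climbs-tail c)
  ... | no  b≢m  = mk⇔ (λ _ → fresh (here refl) b≢m) (λ _ → climbs-ascends b≢m c) , from rest (climbs-tail c)

max-not-fresh : ∀ {M seen y} → NubIsAscbot seen y → M ∈ y → M ∉ seen → All (_≤ M) y → ⊥
max-not-fresh {M} {seen} {b ∷ t} (b↑⇔fresh , nub-t) M∈ M∉seen (_ ∷ t≤M) with M ≟ b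
... | yes refl = ≤⇒¬<Head t≤M (from b↑⇔fresh M∉seen)
... | no  M≢b  = max-not-fresh nub-t (Any.tail M≢b M∈) M∉seen+b t≤M
  where
  M∉seen+b : M ∉ seen ++ b ∷ []
  M∉seen+b M∈ with ∈-++⁻ seen M∈
  ... | inj₁ M∈seen     = M∉seen M∈seen
  ... | inj₂ (here M≡b) = M≢b M≡b

head-is-max : ∀ {a y} → (∀ {i} → i < maxW (a ∷ y) → suc i ∈ a ∷ y) → NubIsAscbot (a ∷ []) y →
              maxW (a ∷ y) ≡ a
head-is-max {a} {y} covers nub with maxW (a ∷ y) ≟ a
... | yes max≡a = max≡a
... | no  max≢a =
  ⊥-elim (max-not-fresh nub (Any.tail max≢a max∈) (∉-singleton max≢a) (All.tabulate (∈⇒≤maxW ∘ there)))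
  where
  a<max : a < maxW (a ∷ y)
  a<max = ≤∧≢⇒< (∈⇒≤maxW {x = a ∷ y} (here refl)) (max≢a ∘ sym)
  max∈ : maxW (a ∷ y) ∈ a ∷ y
  max∈ = top∈ (maxW (a ∷ y)) covers (≤-trans (s≤s z≤n) a<max)

no-211⇒occ≤1 : ∀ {a y} → All (_≤ a) y → ¬ Contains211 (a ∷ y) → ∀ {c} → c ≢ a → occ c y ≤ 1
no-211⇒occ≤1 {a} {y} y≤a no-pattern {c} c≢a with occ c y ≤? 1
... | yes occ≤1 = occ≤1
... | no  occ≰1 = ⊥-elim (no-pattern (a , c , c<a , refl ∷ 2≤occ⇒⊆ y (≰⇒> occ≰1)))
  where
  c<a : c < a
  c<a = ≤∧≢⇒< (All.lookup y≤a (0<occ⇒∈ y (≤-trans (s≤s z≤n) (≰⇒> occ≰1)))) c≢a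

admissible⇒ras∧avoids : ∀ {m y} → Admissible m 1 y → T (isRevisedAscent (m ∷ y) ∧ avoids (m ∷ y) σ₂₁₁)
admissible⇒ras∧avoids {m} {y} adm = from T-∧ (from T-∧ (cayley , ascbot) , avoid)
  where
  open Admissible adm
  y≤m : All (_≤ m) y
  y≤m = All.map proj₂ bounded
  covers : ∀ {i} → i < maxW (m ∷ y) → suc i ∈ m ∷ y
  covers {i} i<max with suc i ≟ m
  ... | yes i+1≡m = here i+1≡m
  ... | no  i+1≢m = there (0<occ⇒∈ y (≤-reflexive (sym (once (s≤s z≤n) i+1<m))))
    where
    i+1<m : suc i < m
    i+1<m = ≤∧≢⇒< (subst (suc i ≤_) (maxW-head y≤m) i<max) i+1≢m
  cayley : T (isCayley (m ∷ y))
  cayley = from (T-isCayley⇔ (m ∷ y)) covers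
  ascbot : T (ascbotEqNub (m ∷ y))
  ascbot = from (T-ascbotEqNub⇔ m y)
                (from (nubIsAscbot⇔climbs (here refl) y≤m (λ _ → ∉-singleton) (admissible-occ≤1 adm)) climbs)
  no-pattern : ¬ Contains211 (m ∷ y)
  no-pattern (a , b , b<a , p) = <⇒≱ (⊆⇒2≤occ (∷⁻ p)) (admissible-occ≤1 adm b≢m)
    where
    b≢m : b ≢ m
    b≢m = <⇒≢ (<-≤-trans b<a (All.lookup (≤-refl ∷ y≤m) (⊆-lookup p (here refl))))
  avoid : T (avoids (m ∷ y) σ₂₁₁)
  avoid = from (T-not⇔ (T-contains-σ₂₁₁⇔ (m ∷ y))) no-pattern

ras∧avoids⇒admissible : ∀ {a y} → All (1 ≤_) y → T (isRevisedAscent (a ∷ y) ∧ avoids (a ∷ y) σ₂₁₁) →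
                        Admissible a 1 y
ras∧avoids⇒admissible {a} {y} y≥1 t = record
  { bounded = All.zip (y≥1 , y≤a)
  ; once    = once
  ; climbs  = to (nubIsAscbot⇔climbs (here refl) y≤a (λ _ → ∉-singleton) occ≤1) nub
  }
  where
  ras : T (isRevisedAscent (a ∷ y))
  ras = proj₁ (to T-∧ t)
  covers : ∀ {i} → i < maxW (a ∷ y) → suc i ∈ a ∷ y
  covers = to (T-isCayley⇔ (a ∷ y)) (proj₁ (to T-∧ ras))
  nub : NubIsAscbot (a ∷ []) y
  nub = to (T-ascbotEqNub⇔ a y) (proj₂ (to T-∧ ras))
  max≡a : maxW (a ∷ y) ≡ a
  max≡a = head-is-max covers nub
  y≤a : All (_≤ a) y
  y≤a = All.tabulate (λ c∈y → subst (_ ≤_) max≡a (∈⇒≤maxW (there c∈y)))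
  occ≤1 : ∀ {c} → c ≢ a → occ c y ≤ 1
  occ≤1 = no-211⇒occ≤1 y≤a (to (T-not⇔ (T-contains-σ₂₁₁⇔ (a ∷ y))) (proj₂ (to T-∧ t)))
  once : ∀ {w} → 1 ≤ w → w < a → occ w y ≡ 1
  once {suc i} _ i<a = ≤-antisym (occ≤1 (<⇒≢ i<a)) (∈⇒0<occ w∈y)
    where
    w∈y : suc i ∈ y
    w∈y = Any.tail (<⇒≢ i<a) (covers (subst (suc i ≤_) (sym max≡a) (<⇒≤ i<a)))

-- Inserting a value at the start of a run

-- The runs of y are its segments ending in m, numbered from 0; v is put in front of run r.
insertInRun : ℕ → ℕ → ℕ → List ℕ → List ℕ
insertInRun m zero    v y       = v ∷ y
insertInRun m (suc r) v []      = []
insertInRun m (suc r) v (a ∷ y) with m ≟ a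
... | yes _ = a ∷ insertInRun m r v y
... | no  _ = a ∷ insertInRun m (suc r) v y

runOf : ℕ → ℕ → List ℕ → ℕ
runOf m v []      = 0
runOf m v (a ∷ y) with v ≟ a
... | yes _ = 0
... | no  _ with m ≟ a
...   | yes _ = suc (runOf m v y)
...   | no  _ = runOf m v y

delete : ℕ → List ℕ → List ℕ
delete v []      = []
delete v (a ∷ y) with v ≟ a
... | yes _ = y
... | no  _ = a ∷ delete v y

insertInRun-top : ∀ m r v y → insertInRun m (suc r) v (m ∷ y) ≡ m ∷ insertInRun m r v y
insertInRun-top m r v y with m ≟ m
... | yes _   = refl
... | no  m≢m = ⊥-elim (m≢m refl)

insertInRun-skip : ∀ {m a} r v y → m ≢ a → insertInRun m (suc r) v (a ∷ y) ≡ a ∷ insertInRun m (suc r) v y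
insertInRun-skip {m} {a} r v y m≢a with m ≟ a
... | yes m≡a = ⊥-elim (m≢a m≡a)
... | no  _   = refl

runOf-here : ∀ m v y → runOf m v (v ∷ y) ≡ 0
runOf-here m v y with v ≟ v
... | yes _   = refl
... | no  v≢v = ⊥-elim (v≢v refl)

runOf-top : ∀ {m v} y → v ≢ m → runOf m v (m ∷ y) ≡ suc (runOf m v y)
runOf-top {m} {v} y v≢m with v ≟ m
... | yes v≡m = ⊥-elim (v≢m v≡m)
... | no  _ with m ≟ m
...   | yes _   = refl
...   | no  m≢m = ⊥-elim (m≢m refl)

runOf-skip : ∀ {m v a} y → v ≢ a → m ≢ a → runOf m v (a ∷ y) ≡ runOf m v y
runOf-skip {m} {v} {a} y v≢a m≢a with v ≟ a
... | yes v≡a = ⊥-elim (v≢a v≡a)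
... | no  _ with m ≟ a
...   | yes m≡a = ⊥-elim (m≢a m≡a)
...   | no  _   = refl

delete-here : ∀ v y → delete v (v ∷ y) ≡ y
delete-here v y with v ≟ v
... | yes _   = refl
... | no  v≢v = ⊥-elim (v≢v refl)

delete-there : ∀ {v a} y → v ≢ a → delete v (a ∷ y) ≡ a ∷ delete v y
delete-there {v} {a} y v≢a with v ≟ a
... | yes v≡a = ⊥-elim (v≢a v≡a)
... | no  _   = refl

insertInRun-↭ : ∀ m r v y → r < occ m y → insertInRun m r v y ↭ v ∷ y
insertInRun-↭ m zero    v y       _ = ↭-refl
insertInRun-↭ m (suc r) v (a ∷ y) r<occ with m ≟ a
... | yes refl = ↭-trans (↭-prep m (insertInRun-↭ m r v y (≤-pred (subst (suc r <_) (occ-here m y) r<occ))))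
                         (↭-swap m v ↭-refl)
... | no  m≢a  = ↭-trans (↭-prep a (insertInRun-↭ m (suc r) v y (subst (suc r <_) (occ-there y m≢a) r<occ)))
                         (↭-swap a v ↭-refl)

delete-↭ : ∀ {v y} → v ∈ y → v ∷ delete v y ↭ y
delete-↭ {v} {a ∷ y} v∈ with v ≟ a
... | yes refl = ↭-refl
... | no  v≢a  = ↭-trans (↭-swap v a ↭-refl) (↭-prep a (delete-↭ (Any.tail v≢a v∈)))

occ-insertInRun : ∀ {w} m r {v y} → w ≢ v → r < occ m y → occ w (insertInRun m r v y) ≡ occ w y
occ-insertInRun {w} m r {v} {y} w≢v r<occ = trans (occ-resp-↭ w (insertInRun-↭ m r v y r<occ)) (occ-there y w≢v)

occ-delete : ∀ {w v y} → w ≢ v → v ∈ y → occ w (delete v y) ≡ occ w y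
occ-delete {w} {v} {y} w≢v v∈y = trans (sym (occ-there (delete v y) w≢v)) (occ-resp-↭ w (delete-↭ v∈y))

<Head-insertInRun : ∀ {a} m r v y → a <Head y → a <Head insertInRun m (suc r) v y
<Head-insertInRun m r v (b ∷ y) a<b with m ≟ b
... | yes _ = a<b
... | no  _ = a<b

climbs-insertInRun : ∀ {m} r {v y} → All (v <_) y → r < occ m y → Climbs m y → Climbs m (insertInRun m r v y)
climbs-insertInRun zero {y = b ∷ y} (v<b ∷ _) _ c = up v<b c
climbs-insertInRun {m} (suc r) {v} {a ∷ y} (_ ∷ v<y) r<occ c with m ≟ a
... | yes refl = top (climbs-insertInRun r v<y (≤-pred (subst (suc r <_) (occ-here m y) r<occ)) (climbs-tail c))
... | no  m≢a  = up (<Head-insertInRun m r v y (climbs-ascends (m≢a ∘ sym) c))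
                    (climbs-insertInRun (suc r) v<y (subst (suc r <_) (occ-there y m≢a) r<occ) (climbs-tail c))

<Head-delete : ∀ {v a} t → v ≤ a → a <Head t → a <Head delete v t
<Head-delete {v} (b ∷ t) v≤a a<b with v ≟ b
... | yes refl = ⊥-elim (<⇒≱ a<b v≤a)
... | no  _    = a<b

climbs-delete : ∀ {m v y} → All (v ≤_) y → Climbs m y → Climbs m (delete v y)
climbs-delete {y = []} [] [] = []
climbs-delete {v = v} {a ∷ y} (v≤a ∷ v≤y) c with v ≟ a
... | yes refl = climbs-tail c
climbs-delete (_ ∷ v≤y) (top c) | no _ = top (climbs-delete v≤y c)
climbs-delete {y = _ ∷ y} (v≤a ∷ v≤y) (up a<y c) | no _ = up (<Head-delete y v≤a a<y) (climbs-delete v≤y c)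

delete-insertInRun : ∀ m r {v y} → v ∉ y → delete v (insertInRun m r v y) ≡ y
delete-insertInRun m zero    {v} {y}     _  = delete-here v y
delete-insertInRun m (suc r) {y = []}    _  = refl
delete-insertInRun m (suc r) {v} {a ∷ y} v∉ with m ≟ a
... | yes _ = trans (delete-there _ (v∉ ∘ here)) (cong (a ∷_) (delete-insertInRun m r (v∉ ∘ there)))
... | no  _ = trans (delete-there _ (v∉ ∘ here)) (cong (a ∷_) (delete-insertInRun m (suc r) (v∉ ∘ there)))

runOf-insertInRun : ∀ m r {v y} → v ∉ y → r < occ m y → runOf m v (insertInRun m r v y) ≡ r
runOf-insertInRun m zero    {v} {y}     _  _ = runOf-here m v y
runOf-insertInRun m (suc r) {v} {a ∷ y} v∉ r<occ with m ≟ a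
... | yes refl = trans (runOf-top _ (v∉ ∘ here))
                       (cong suc (runOf-insertInRun m r (v∉ ∘ there) (≤-pred (subst (suc r <_) (occ-here m y) r<occ))))
... | no  m≢a  = trans (runOf-skip _ (v∉ ∘ here) m≢a)
                       (runOf-insertInRun m (suc r) (v∉ ∘ there) (subst (suc r <_) (occ-there y m≢a) r<occ))

runOf-pos : ∀ {m v y} → Climbs m y → v <Head y → v ∈ y → 0 < runOf m v y
runOf-pos {m} {v} {b ∷ t} c v<b v∈ with v ≟ b
... | yes refl = ⊥-elim (<-irrefl refl v<b)
... | no  v≢b with m ≟ b
...   | yes _   = s≤s z≤n
...   | no  m≢b = runOf-pos (climbs-tail c) (<-<Head-trans t v<b (climbs-ascends (m≢b ∘ sym) c)) (Any.tail v≢b v∈)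

runOf<occ : ∀ {m v y} → Climbs m y → v ≢ m → v ∈ y → runOf m v y < occ m y
runOf<occ {m} {v} {a ∷ t} c v≢m v∈ with v ≟ a
... | yes refl = subst (0 <_) (sym (occ-there t (v≢m ∘ sym)))
                       (0<occ-climbs (climbs-tail c) (<Head⇒0<length t (climbs-ascends v≢m c)))
... | no  v≢a with m ≟ a
...   | yes refl = subst (suc (runOf m v t) <_) (sym (occ-here m t))
                         (s≤s (runOf<occ (climbs-tail c) v≢m (Any.tail v≢a v∈)))
...   | no  m≢a  = subst (runOf m v t <_) (sym (occ-there t m≢a)) (runOf<occ (climbs-tail c) v≢m (Any.tail v≢a v∈))

insertInRun-runOf : ∀ {m v y} → Climbs m y → All (v ≤_) y → v ∈ y →
                    insertInRun m (runOf m v y) v (delete v y) ≡ y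
insertInRun-runOf {m} {v} {a ∷ t} c (v≤a ∷ v≤t) v∈ with v ≟ a
... | yes refl = refl
... | no  v≢a with m ≟ a
...   | yes refl = trans (insertInRun-top m (runOf m v t) v (delete v t))
                         (cong (m ∷_) (insertInRun-runOf (climbs-tail c) v≤t (Any.tail v≢a v∈)))
...   | no  m≢a
  with runOf m v t
     | runOf-pos (climbs-tail c) (<-<Head-trans t (≤∧≢⇒< v≤a v≢a) (climbs-ascends (m≢a ∘ sym) c)) (Any.tail v≢a v∈)
     | insertInRun-runOf (climbs-tail c) v≤t (Any.tail v≢a v∈)
... | suc r | _ | ih = trans (insertInRun-skip r v (delete v t) m≢a) (cong (a ∷_) ih)

insertInRun-admissible : ∀ {m v} r {y} → Admissible m (suc v) y → v < m → r < occ m y →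
                         Admissible m v (insertInRun m r v y)
insertInRun-admissible {m} {v} r {y} adm v<m r<occ = record
  { bounded = All-resp-↭ (↭-sym (insertInRun-↭ m r v y r<occ))
                         ((≤-refl , <⇒≤ v<m) ∷ All.map (λ (v<a , a≤m) → <⇒≤ v<a , a≤m) bounded)
  ; once    = once′
  ; climbs  = climbs-insertInRun r (All.map proj₁ bounded) r<occ climbs
  }
  where
  open Admissible adm
  once′ : ∀ {w} → v ≤ w → w < m → occ w (insertInRun m r v y) ≡ 1
  once′ {w} v≤w w<m with w ≟ v
  ... | yes refl = trans (occ-resp-↭ w (insertInRun-↭ m r v y r<occ)) (trans (occ-here w y) (cong suc (∉⇒occ≡0 y v∉y)))
    where
    v∉y : v ∉ y
    v∉y v∈y = <-irrefl refl (proj₁ (All.lookup bounded v∈y))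
  ... | no  w≢v  = trans (occ-insertInRun m r w≢v r<occ) (once (≤∧≢⇒< v≤w (w≢v ∘ sym)) w<m)

delete-admissible : ∀ {m v y} → Admissible m v y → v < m → Admissible m (suc v) (delete v y)
delete-admissible {m} {v} {y} adm v<m = record
  { bounded = All.tabulate bounds
  ; once    = λ v<w w<m → trans (occ-delete (≢-sym (<⇒≢ v<w)) v∈y) (once (<⇒≤ v<w) w<m)
  ; climbs  = climbs-delete (All.map proj₁ bounded) climbs
  }
  where
  open Admissible adm
  v∈y = admissible-∈ adm v<m
  v∉rest : v ∉ delete v y
  v∉rest v∈ = <⇒≢ (∈⇒0<occ v∈) (sym (suc-injective
    (trans (sym (occ-here v (delete v y))) (trans (occ-resp-↭ v (delete-↭ v∈y)) (once ≤-refl v<m)))))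
  bounds : ∀ {a} → a ∈ delete v y → suc v ≤ a × a ≤ m
  bounds {a} a∈ with All.lookup bounded (∈-resp-↭ (delete-↭ v∈y) (there a∈))
  ... | v≤a , a≤m = ≤∧≢⇒< v≤a (λ v≡a → v∉rest (subst (_∈ delete v y) (sym v≡a) a∈)) , a≤m

replicate-admissible : ∀ m k → Admissible m m (replicate k m)
replicate-admissible m k = record
  { bounded = replicate⁺ k (≤-refl , ≤-refl)
  ; once    = λ m≤w w<m → ⊥-elim (<⇒≱ w<m m≤w)
  ; climbs  = climbs-replicate k
  }
  where
  climbs-replicate : ∀ k → Climbs m (replicate k m)
  climbs-replicate zero    = []
  climbs-replicate (suc k) = top (climbs-replicate k)

-- Encoding by run indices

-- The i-th letter j of the code sends the value v + i to the front of run j − 1. Larger values are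
-- inserted first, so every insertion keeps the runs increasing.
encode : ℕ → ℕ → ℕ → List ℕ → List ℕ
encode m k v []      = replicate k m
encode m k v (j ∷ c) = insertInRun m (pred j) v (encode m k (suc v) c)

-- d = m − v is the number of values still to be read off.
decode : ℕ → ℕ → ℕ → List ℕ → List ℕ
decode m zero    v y = []
decode m (suc d) v y = suc (runOf m v y) ∷ decode m d (suc v) (delete v y)

suc-+⇒+-suc : ∀ {d v m} → suc (d + v) ≡ m → d + suc v ≡ m
suc-+⇒+-suc {d} {v} eq = trans (+-suc d v) eq

suc-+⇒< : ∀ {d v m} → suc (d + v) ≡ m → v < m
suc-+⇒< {d} {v} eq = subst (v <_) eq (s≤s (m≤n+m v d))

encode-occ : ∀ {m k} v c → WordOver k c → length c + v ≡ m → occ m (encode m k v c) ≡ k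
encode-occ {m} {k} v []          _                refl = occ-replicate k m
encode-occ         v (zero ∷ c)  ((() , _) ∷ _)   _
encode-occ {m} {k} v (suc j ∷ c) ((_ , j<k) ∷ wc) eq   =
  trans (occ-insertInRun m j (≢-sym (<⇒≢ (suc-+⇒< eq))) (subst (j <_) (sym ih) j<k)) ih
  where
  ih = encode-occ (suc v) c wc (suc-+⇒+-suc eq)

run<occ-encode : ∀ {m k j} v c → WordOver k c → length c + suc v ≡ m → j < k → j < occ m (encode m k (suc v) c)
run<occ-encode v c wc eq j<k = subst (_ <_) (sym (encode-occ (suc v) c wc eq)) j<k

encode-admissible : ∀ {m k} v c → WordOver k c → length c + v ≡ m → Admissible m v (encode m k v c)
encode-admissible     {k = k} v []          _                refl = replicate-admissible v k
encode-admissible             v (zero ∷ c)  ((() , _) ∷ _)   _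
encode-admissible             v (suc j ∷ c) ((_ , j<k) ∷ wc) eq   =
  insertInRun-admissible j (encode-admissible (suc v) c wc (suc-+⇒+-suc eq)) (suc-+⇒< eq)
                         (run<occ-encode v c wc (suc-+⇒+-suc eq) j<k)

length-encode : ∀ {m k} v c → WordOver k c → length c + v ≡ m → v + length (encode m k v c) ≡ k + m
length-encode {k = k} v []          _                refl = trans (cong (v +_) (length-replicate k)) (+-comm v k)
length-encode         v (zero ∷ c)  ((() , _) ∷ _)   _
length-encode {m} {k} v (suc j ∷ c) ((_ , j<k) ∷ wc) eq   = begin
  v + length (insertInRun m j v Y) ≡⟨ cong (v +_) (↭-length (insertInRun-↭ m j v Y (run<occ-encode v c wc eq′ j<k))) ⟩
  v + suc (length Y)               ≡⟨ +-suc v (length Y) ⟩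
  suc v + length Y                 ≡⟨ length-encode (suc v) c wc eq′ ⟩
  k + m                            ∎
  where
  open ≡-Reasoning
  Y   = encode m k (suc v) c
  eq′ = suc-+⇒+-suc eq

decode-encode : ∀ {m k} v c → WordOver k c → length c + v ≡ m → decode m (length c) v (encode m k v c) ≡ c
decode-encode         v []          _                _  = refl
decode-encode         v (zero ∷ c)  ((() , _) ∷ _)   _
decode-encode {m} {k} v (suc j ∷ c) ((_ , j<k) ∷ wc) eq =
  cong₂ _∷_ (cong suc (runOf-insertInRun m j v∉Y j<occ))
            (trans (cong (decode m (length c) (suc v)) (delete-insertInRun m j v∉Y)) (decode-encode (suc v) c wc eq′))
  where
  eq′ = suc-+⇒+-suc eq
  Y   = encode m k (suc v) c
  j<occ : j < occ m Y
  j<occ = run<occ-encode v c wc eq′ j<k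
  v∉Y : v ∉ Y
  v∉Y v∈Y = <-irrefl refl (proj₁ (All.lookup (Admissible.bounded (encode-admissible (suc v) c wc eq′)) v∈Y))

encode-decode : ∀ {m} d {v y} → Admissible m v y → d + v ≡ m →
                WordOver (occ m y) (decode m d v y) × encode m (occ m y) v (decode m d v y) ≡ y
encode-decode zero adm refl =
  [] , replicate-occ (All.map (λ (m≤a , a≤m) → ≤-antisym a≤m m≤a) (Admissible.bounded adm))
encode-decode {m} (suc d) {v} {y} adm eq = word , equation
  where
  open Admissible adm
  v<m = suc-+⇒< eq
  v∈y = admissible-∈ adm v<m
  occ-same : occ m (delete v y) ≡ occ m y
  occ-same = occ-delete (≢-sym (<⇒≢ v<m)) v∈y
  code = decode m d (suc v) (delete v y)
  ih = encode-decode d (delete-admissible adm v<m) (suc-+⇒+-suc eq)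
  word : WordOver (occ m y) (suc (runOf m v y) ∷ code)
  word = (s≤s z≤n , runOf<occ climbs (<⇒≢ v<m) v∈y) ∷ subst (λ K → WordOver K code) occ-same (proj₁ ih)
  equation : insertInRun m (runOf m v y) v (encode m (occ m y) (suc v) code) ≡ y
  equation = trans (cong (insertInRun m (runOf m v y) v)
                         (subst (λ K → encode m K (suc v) code ≡ delete v y) occ-same (proj₂ ih)))
                   (insertInRun-runOf climbs (All.map proj₁ bounded) v∈y)

decode-encode-word : ∀ {m k c} → 0 < m → c ∈ wordsOver k (m ∸ 1) → decode m (m ∸ 1) 1 (encode m k 1 c) ≡ c
decode-encode-word {m} {k} {c} 0<m c∈ with ∈-wordsOver⁻ k (m ∸ 1) c∈
... | length-c , word-c = subst (λ d → decode m d 1 (encode m k 1 c) ≡ c) length-c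
                                (decode-encode 1 c word-c (trans (cong (_+ 1) length-c) (m∸n+n≡m 0<m)))

length-decode : ∀ m d v y → length (decode m d v y) ≡ d
length-decode m zero    v y = refl
length-decode m (suc d) v y = cong suc (length-decode m d (suc v) (delete v y))

-- The enumeration

-- The sequences of B̂ₙ(211) whose maximum n − k occurs k + 1 times.
enumerationₖ : ℕ → ℕ → List (List ℕ)
enumerationₖ n k = map (λ c → (n ∸ k) ∷ encode (n ∸ k) k 1 c) (wordsOver k (n ∸ k ∸ 1))

enumeration : ℕ → List (List ℕ)
enumeration n = concatMap (enumerationₖ n) (applyUpTo suc (n ∸ 1))

∈-range⁻ : ∀ {n k} → k ∈ applyUpTo suc (n ∸ 1) → 1 ≤ k × k < n
∈-range⁻ {suc n} k∈ with ∈-applyUpTo⁻ suc k∈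
... | i , i<n , refl = s≤s z≤n , s≤s i<n

∈-range⁺ : ∀ {n k} → 1 ≤ k → k < n → k ∈ applyUpTo suc (n ∸ 1)
∈-range⁺ {suc n} {suc i} _ (s≤s i<n) = ∈-applyUpTo⁺ suc i<n

length-enumeration : ∀ n → length (enumeration n) ≡ rhs n
length-enumeration n =
  trans (length-concatMap (enumerationₖ n) (applyUpTo suc (n ∸ 1)))
        (cong sum (map-cong (λ k → trans (length-map _ (wordsOver k (n ∸ k ∸ 1))) (length-wordsOver k (n ∸ k ∸ 1)))
                            (applyUpTo suc (n ∸ 1))))

unique-enumeration : ∀ n → Unique (enumeration n)
unique-enumeration n =
  unique-concatMap (enumerationₖ n) (Unique.applyUpTo⁺₁ suc (n ∸ 1) (λ i<j _ → <⇒≢ i<j ∘ suc-injective))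
                   unique-part same-maximum
  where
  unique-part : ∀ {k} → k ∈ applyUpTo suc (n ∸ 1) → Unique (enumerationₖ n k)
  unique-part {k} k∈ = unique-map _ injective (unique-wordsOver k (n ∸ k ∸ 1))
    where
    0<m : 0 < n ∸ k
    0<m = m<n⇒0<n∸m (proj₂ (∈-range⁻ {n} k∈))
    injective : ∀ {c c′} → c ∈ wordsOver k (n ∸ k ∸ 1) → c′ ∈ wordsOver k (n ∸ k ∸ 1) →
                (n ∸ k) ∷ encode (n ∸ k) k 1 c ≡ (n ∸ k) ∷ encode (n ∸ k) k 1 c′ → c ≡ c′
    injective c∈ c′∈ eq = trans (sym (decode-encode-word 0<m c∈))
                                (trans (cong (decode (n ∸ k) (n ∸ k ∸ 1) 1) (∷-injectiveʳ eq)) (decode-encode-word 0<m c′∈))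
  same-maximum : ∀ {k k′ x} → k ∈ applyUpTo suc (n ∸ 1) → k′ ∈ applyUpTo suc (n ∸ 1) →
                 x ∈ enumerationₖ n k → x ∈ enumerationₖ n k′ → k ≡ k′
  same-maximum k∈ k′∈ x∈ x∈′ with ∈-map⁻ _ x∈ | ∈-map⁻ _ x∈′
  ... | _ , _ , refl | _ , _ , eq =
    ∸-cancelˡ-≡ (<⇒≤ (proj₂ (∈-range⁻ {n} k∈))) (<⇒≤ (proj₂ (∈-range⁻ {n} k′∈))) (∷-injectiveˡ eq)

enumeration-sound : ∀ {n x} → x ∈ enumeration n → x ∈ wordsOver n n × T (isRevisedAscent x ∧ avoids x σ₂₁₁)
enumeration-sound {n} x∈ with find (∈-concatMap⁻ (enumerationₖ n) {xs = applyUpTo suc (n ∸ 1)} x∈)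
... | k , k∈ , x∈ₖ with ∈-map⁻ _ x∈ₖ | ∈-range⁻ {n} k∈
... | c , c∈ , refl | _ , k<n = ∈-wordsOver⁺ n length-x word , admissible⇒ras∧avoids adm
  where
  m = n ∸ k
  0<m : 0 < m
  0<m = m<n⇒0<n∸m k<n
  word-c : WordOver k c
  word-c = proj₂ (∈-wordsOver⁻ k (m ∸ 1) c∈)
  L+1≡m : length c + 1 ≡ m
  L+1≡m = trans (cong (_+ 1) (proj₁ (∈-wordsOver⁻ k (m ∸ 1) c∈))) (m∸n+n≡m 0<m)
  adm = encode-admissible 1 c word-c L+1≡m
  length-x : length (m ∷ encode m k 1 c) ≡ n
  length-x = trans (length-encode 1 c word-c L+1≡m) (m+[n∸m]≡n (<⇒≤ k<n))
  word : WordOver n (m ∷ encode m k 1 c)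
  word = (0<m , m∸n≤m n k) ∷ All.map (λ (1≤a , a≤m) → 1≤a , ≤-trans a≤m (m∸n≤m n k)) (Admissible.bounded adm)

enumeration-complete : ∀ {n x} → 2 ≤ n → x ∈ wordsOver n n → T (isRevisedAscent x ∧ avoids x σ₂₁₁) →
                       x ∈ enumeration n
enumeration-complete {n} {x} 2≤n x∈ t with ∈-wordsOver⁻ n n x∈
enumeration-complete {n} {[]}    2≤n x∈ t | refl , _ = ⊥-elim (<⇒≱ 2≤n z≤n)
enumeration-complete {n} {a ∷ y} 2≤n x∈ t | length-x , (1≤a , _) ∷ word-y =
  ∈-concatMap⁺ (enumerationₖ n) (lose (∈-range⁺ 0<k k<n) (subst (_∈ enumerationₖ n k) x≡ (∈-map⁺ _ c∈)))
  where
  adm = ras∧avoids⇒admissible (All.map proj₁ word-y) t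
  k = occ a y
  c = decode a (a ∸ 1) 1 y
  length-c : length c ≡ a ∸ 1
  length-c = length-decode a (a ∸ 1) 1 y
  d+1≡a : a ∸ 1 + 1 ≡ a
  d+1≡a = m∸n+n≡m 1≤a
  word-c : WordOver k c
  word-c = proj₁ (encode-decode (a ∸ 1) adm d+1≡a)
  encode≡y : encode a k 1 c ≡ y
  encode≡y = proj₂ (encode-decode (a ∸ 1) adm d+1≡a)
  n≡k+a : n ≡ k + a
  n≡k+a = begin
    n                             ≡⟨ length-x ⟨
    suc (length y)                ≡⟨ cong (suc ∘ length) encode≡y ⟨
    suc (length (encode a k 1 c)) ≡⟨ length-encode 1 c word-c (trans (cong (_+ 1) length-c) d+1≡a) ⟩
    k + a                         ∎
    where open ≡-Reasoning
  n∸k≡a : n ∸ k ≡ a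
  n∸k≡a = trans (cong (_∸ k) n≡k+a) (m+n∸m≡n k a)
  k<n : k < n
  k<n = subst (k <_) (sym n≡k+a) (m<m+n k 1≤a)
  0<k : 0 < k
  0<k = 0<occ-climbs (Admissible.climbs adm) (≤-pred (subst (2 ≤_) (sym length-x) 2≤n))
  c∈ : c ∈ wordsOver k (n ∸ k ∸ 1)
  c∈ = ∈-wordsOver⁺ (n ∸ k ∸ 1) (trans length-c (cong (_∸ 1) (sym n∸k≡a))) word-c
  x≡ : (n ∸ k) ∷ encode (n ∸ k) k 1 c ≡ a ∷ y
  x≡ rewrite n∸k≡a = cong (a ∷_) encode≡y

mainTheorem9 : (n : ℕ) → 2 ≤ n → countB n (2 ∷ 1 ∷ 1 ∷ []) ≡ rhs n
mainTheorem9 n 2≤n = begin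
  countB n σ₂₁₁
    ≡⟨ unique∧set⇒length≡ (Unique.filter⁺ P? (unique-wordsOver n n)) (unique-enumeration n) same-elements ⟩
  length (enumeration n)
    ≡⟨ length-enumeration n ⟩
  rhs n
    ∎
  where
  open ≡-Reasoning
  P? = λ x → T? (isRevisedAscent x ∧ avoids x σ₂₁₁)
  same-elements : ∀ {x} → x ∈ filter P? (wordsOver n n) ⇔ x ∈ enumeration n
  same-elements = mk⇔ (λ x∈ → let x∈words , pb = ∈-filter⁻ P? x∈ in enumeration-complete {n} 2≤n x∈words pb)
                      (λ x∈ → let x∈words , pb = enumeration-sound {n} x∈ in ∈-filter⁺ P? x∈words pb)
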